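{- Let $\mathcal S\subseteq\{ -1,0,1\}^d\setminus\{\mathbf 0\}$ be a set of unit steps in dimension $d$. Suppose $\mathcal S$ is symmetric with respect to each axis and, for each coordinate $k$, $\mathcal S$ contains a step whose $k$-th coordinate is $1$. Let $e_n$ be the number of walks of length $n$ taking steps in $\mathcal S$, beginning and ending at the origin, and never leaving the orthant $\mathbb{Z}_{\ge0}^d$. Then $$e_n=O\!\left(\frac{|\mathcal S|^n}{n^{3d/2}}\right).$$
   Context: Symmetric with respect to each axis means $(i_1,\dots,i_k,\dots,i_d)\in\mathcal{S}$ implies $(i_1,\dots,-i_k,\dots,i_d)\in\mathcal{S}$ for every $k$. -}

module Defs where

open import Data.Nat using (ℕ; zero; suc)
open import Data.Integer using (ℤ; +_; _+_; -_; _≤ᵇ_; 0ℤ; 1ℤ; -1ℤ)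
open import Data.Bool using (Bool; true; false; _∧_; if_then_else_)
open import Data.List using (List; []; _∷_; length; filter; map; concatMap)
open import Data.Vec using (Vec; zipWith; replicate; lookup; _[_]≔_)
import Data.Vec as V
open import Data.Fin using (Fin)
open import Data.Product using (∃; _×_; Σ)
open import Data.Sum using (_⊎_)
open import Data.List.Membership.Propositional using (_∈_)
open import Data.List.Relation.Unary.Unique.Propositional using (Unique)
open import Relation.Binary.PropositionalEquality using (_≡_; _≢_)
open import Relation.Nullary using (¬_)
open import Data.Bool using (T)

Pt : ℕ → Set
Pt d = Vec ℤ d

origin : ∀ {d} → Pt d
origin = replicate _ 0ℤ

_⊕_ : ∀ {d} → Pt d → Pt d → Pt d
_⊕_ = zipWith _+_

UnitStep : ∀ {d} → Pt d → Set
UnitStep {d} s = (∀ (k : Fin d) → lookup s k ≡ -1ℤ ⊎ lookup s k ≡ 0ℤ ⊎ lookup s k ≡ 1ℤ)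
               × s ≢ origin

-- A step set S ⊆ {-1,0,1}^d \ {0}, given as a duplicate-free list (so |S| = length S).
IsStepSet : ∀ {d} → List (Pt d) → Set
IsStepSet S = Unique S × (∀ {s} → s ∈ S → UnitStep s)

AxisSymmetric : ∀ {d} → List (Pt d) → Set
AxisSymmetric {d} S = ∀ {s} → s ∈ S → (k : Fin d) → (s [ k ]≔ (- lookup s k)) ∈ S

HasPositiveInEachCoord : ∀ {d} → List (Pt d) → Set
HasPositiveInEachCoord {d} S = (k : Fin d) → Σ (Pt d) (λ s → s ∈ S × lookup s k ≡ 1ℤ)

inOrthant : ∀ {d} → Pt d → Bool
inOrthant p = V.foldr _ (λ x b → (0ℤ ≤ᵇ x) ∧ b) true p

isZeroℤ : ℤ → Bool
isZeroℤ (+ zero) = true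
isZeroℤ _ = false

isOrigin : ∀ {d} → Pt d → Bool
isOrigin p = V.foldr _ (λ x b → isZeroℤ x ∧ b) true p

words : ∀ {A : Set} → List A → ℕ → List (List A)
words S zero = [] ∷ []
words S (suc n) = concatMap (λ s → map (s ∷_) (words S n)) S

excursionFrom : ∀ {d} → Pt d → List (Pt d) → Bool
excursionFrom p [] = isOrigin p
excursionFrom p (s ∷ w) = inOrthant (p ⊕ s) ∧ excursionFrom (p ⊕ s) w

isExcursion : ∀ {d} → List (Pt d) → Bool
isExcursion w = excursionFrom origin w

excursionCount : ∀ {d} → List (Pt d) → ℕ → ℕ
excursionCount S n = length (filter (λ w → T? (isExcursion w)) (words S n))
  where
  open import Relation.Nullary.Decidable using (Dec)
  open import Data.Bool.Properties using (T?)

module Submission where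

-- Changing the sign of one coordinate of one step permutes S^n; averaging over all such sign
-- changes decouples the axes:
--   2^(d n) e_n = Σ_{w ∈ S^n} Π_k E(m_k w) 2^(n - m_k w),
-- where m_k w counts the steps of w moving along axis k and E m is the number of 1-dimensional
-- excursions of length m, so E(m)^2 (m + 1)^3 ≤ 3 · 4^m (Catalan numbers). Cauchy–Schwarz and
-- Π_k y_k ≤ Σ_k y_k^d bound (2^(d n) e_n)^2 by |S|^n times a sum over axes of binomial sums
-- Σ_m (n choose m) α^m β^(n - m) g m with g m ≤ (3 · 4^n)^d / (m + 1)^(3 d), α ≥ 1 counting the steps
-- moving along the axis and β = |S| - α. Iterating m (n choose m) = n (n - 1 choose m - 1) shows
-- such a sum is O(4^(d n) |S|^n / n^(3 d)).

open import Defs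
open import Data.Nat
open import Data.Nat.Properties
open import Data.Nat.ListAction using (sum)
open import Data.Nat.ListAction.Properties using (sum-↭; sum-++)
open import Data.Nat.Solver using (module +-*-Solver)
open import Data.Integer as ℤ using (ℤ; -[1+_]; -_; 0ℤ; 1ℤ; -1ℤ)
open import Data.Integer.Properties using (neg-involutive)
open import Data.Bool using (Bool; true; false; _∧_; if_then_else_)
open import Data.Bool.Properties using (T?)
open import Data.Fin using (Fin; zero; suc; toℕ; fromℕ<)
import Data.Fin.Properties as Fin
open import Data.Vec using ([]; _∷_; lookup; _[_]≔_)
open import Data.Vec.Properties
  using (lookup∘update; lookup∘update′; []≔-idempotent; []≔-lookup; lookup-zipWith; lookup-replicate)
open import Data.List using (List; []; _∷_; map; concatMap; _++_; length; filter)
open import Data.List.Properties using (map-∘; map-++)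
open import Data.List.Membership.Propositional using (_∈_)
open import Data.List.Membership.Propositional.Properties using (∈-map⁺; ∈-map⁻)
open import Data.List.Membership.Propositional.Properties.WithK using (unique∧set⇒bag)
open import Data.List.Relation.Unary.Any using (here; there)
open import Data.List.Relation.Unary.Unique.Propositional using (Unique)
import Data.List.Relation.Unary.Unique.Propositional.Properties as Unique
open import Data.List.Relation.Binary.BagAndSetEquality using (∼bag⇒↭)
open import Data.List.Relation.Binary.Permutation.Propositional using (_↭_)
import Data.List.Relation.Binary.Permutation.Propositional.Properties as ↭
open import Data.Product using (Σ; _×_; _,_; proj₁; proj₂)
open import Data.Sum using (_⊎_; inj₁; inj₂; [_,_]′)
open import Function using (_∘_)
open import Function.Bundles using (mk⇔)
open import Relation.Binary.PropositionalEquality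
open import Relation.Nullary using (yes; no; contradiction)

open +-*-Solver

*-^-distrib : ∀ a b j → (a * b) ^ j ≡ a ^ j * b ^ j
*-^-distrib a b zero = refl
*-^-distrib a b (suc j) = trans (cong (a * b *_) (*-^-distrib a b j))
  (solve 4 (λ a b x y → (a :* b) :* (x :* y) := (a :* x) :* (b :* y)) refl a b (a ^ j) (b ^ j))

^-double : ∀ a n → a ^ (2 * n) ≡ a ^ n * a ^ n
^-double a n = trans (cong (a ^_) (cong (n +_) (+-identityʳ n))) (^-distribˡ-+-* a n n)

2^dn²≡4^nd : ∀ d n → (2 ^ d) ^ n * (2 ^ d) ^ n ≡ (4 ^ n) ^ d
2^dn²≡4^nd d n = begin
  (2 ^ d) ^ n * (2 ^ d) ^ n   ≡⟨ cong (λ t → t * t) (trans (^-*-assoc 2 d n) (trans (cong (2 ^_) (*-comm d n)) (sym (^-*-assoc 2 n d)))) ⟩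
  (2 ^ n) ^ d * (2 ^ n) ^ d   ≡⟨ sym (*-^-distrib (2 ^ n) (2 ^ n) d) ⟩
  (2 ^ n * 2 ^ n) ^ d         ≡⟨ cong (_^ d) (sym (*-^-distrib 2 2 n)) ⟩
  (4 ^ n) ^ d ∎
  where open ≡-Reasoning

2xy≤x²+y² : ∀ x y → 2 * x * y ≤ x * x + y * y
2xy≤x²+y² x y = [ ordered , (λ y≤x → subst₂ _≤_ (swapped y x) (+-comm (y * y) (x * x)) (ordered y≤x)) ]′ (≤-total x y)
  where
  ordered : ∀ {x y} → x ≤ y → 2 * x * y ≤ x * x + y * y
  ordered {x} x≤y with m≤n⇒∃[o]m+o≡n x≤y
  ... | t , refl = subst₂ _≤_
        (solve 2 (λ x t → con 2 :* x :* x :+ con 2 :* x :* t := con 2 :* x :* (x :+ t)) refl x t)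
        (solve 2 (λ x t → con 2 :* x :* x :+ con 2 :* x :* t :+ t :* t := x :* x :+ (x :+ t) :* (x :+ t)) refl x t)
        (m≤m+n _ (t * t))
  swapped : ∀ y x → 2 * y * x ≡ 2 * x * y
  swapped = solve 2 (λ y x → con 2 :* y :* x := con 2 :* x :* y) refl

private variable A B : Set

sumBy : (A → ℕ) → List A → ℕ
sumBy f xs = sum (map f xs)

sumBy-↭ : ∀ (f : A → ℕ) {xs ys} → xs ↭ ys → sumBy f xs ≡ sumBy f ys
sumBy-↭ f p = sum-↭ (↭.map⁺ f p)

sumBy-map : ∀ (f : B → ℕ) (g : A → B) xs → sumBy f (map g xs) ≡ sumBy (λ x → f (g x)) xs
sumBy-map f g xs = cong sum (sym (map-∘ xs))

sumBy-++ : ∀ (f : A → ℕ) xs ys → sumBy f (xs ++ ys) ≡ sumBy f xs + sumBy f ys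
sumBy-++ f xs ys = trans (cong sum (map-++ f xs ys)) (sum-++ (map f xs) (map f ys))

sumBy-cong∈ : ∀ xs {f g : A → ℕ} → (∀ {x} → x ∈ xs → f x ≡ g x) → sumBy f xs ≡ sumBy g xs
sumBy-cong∈ [] e = refl
sumBy-cong∈ (x ∷ xs) e = cong₂ _+_ (e (here refl)) (sumBy-cong∈ xs (λ m → e (there m)))

sumBy-cong : ∀ xs {f g : A → ℕ} → (∀ x → f x ≡ g x) → sumBy f xs ≡ sumBy g xs
sumBy-cong xs e = sumBy-cong∈ xs (λ {x} _ → e x)

sumBy-mono : ∀ xs {f g : A → ℕ} → (∀ x → f x ≤ g x) → sumBy f xs ≤ sumBy g xs
sumBy-mono [] e = ≤-refl
sumBy-mono (x ∷ xs) e = +-mono-≤ (e x) (sumBy-mono xs e)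

sumBy-const : ∀ xs c → sumBy (λ (_ : A) → c) xs ≡ length xs * c
sumBy-const [] c = refl
sumBy-const (x ∷ xs) c = cong (c +_) (sumBy-const xs c)

sumBy-+ : ∀ xs (f g : A → ℕ) → sumBy (λ x → f x + g x) xs ≡ sumBy f xs + sumBy g xs
sumBy-+ [] f g = refl
sumBy-+ (x ∷ xs) f g = trans (cong (f x + g x +_) (sumBy-+ xs f g))
  (solve 4 (λ a b c d → a :+ b :+ (c :+ d) := a :+ c :+ (b :+ d)) refl (f x) (g x) _ _)

*-distribˡ-sumBy : ∀ c xs (f : A → ℕ) → c * sumBy f xs ≡ sumBy (λ x → c * f x) xs
*-distribˡ-sumBy c [] f = *-zeroʳ c
*-distribˡ-sumBy c (x ∷ xs) f = trans (*-distribˡ-+ c (f x) _) (cong (c * f x +_) (*-distribˡ-sumBy c xs f))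

*-distribʳ-sumBy : ∀ c xs (f : A → ℕ) → sumBy f xs * c ≡ sumBy (λ x → f x * c) xs
*-distribʳ-sumBy c xs f = trans (*-comm _ c) (trans (*-distribˡ-sumBy c xs f) (sumBy-cong xs (λ x → *-comm c (f x))))

sumBy-comm : ∀ (xs : List A) (ys : List B) (F : A → B → ℕ) →
  sumBy (λ x → sumBy (F x) ys) xs ≡ sumBy (λ y → sumBy (λ x → F x y) xs) ys
sumBy-comm [] ys F = sym (trans (sumBy-const ys 0) (*-zeroʳ (length ys)))
sumBy-comm (x ∷ xs) ys F = trans (cong (sumBy (F x) ys +_) (sumBy-comm xs ys F))
  (sym (sumBy-+ ys (F x) (λ y → sumBy (λ x → F x y) xs)))

∈⇒≤sumBy : ∀ (f : A → ℕ) {x xs} → x ∈ xs → f x ≤ sumBy f xs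
∈⇒≤sumBy f (here refl) = m≤m+n _ _
∈⇒≤sumBy f {xs = y ∷ xs} (there m) = ≤-trans (∈⇒≤sumBy f m) (m≤n+m _ (f y))

sumBy-cauchySchwarz : ∀ (f : A → ℕ) xs → sumBy f xs * sumBy f xs ≤ length xs * sumBy (λ x → f x * f x) xs
sumBy-cauchySchwarz f [] = ≤-refl
sumBy-cauchySchwarz f (x ∷ xs) = begin
  (f x + T) * (f x + T)
    ≡⟨ solve 2 (λ a T → (a :+ T) :* (a :+ T) := a :* a :+ con 2 :* a :* T :+ T :* T) refl (f x) T ⟩
  f x * f x + 2 * f x * T + T * T
    ≤⟨ +-mono-≤ (+-monoʳ-≤ (f x * f x) (cross-term (f x) xs)) (sumBy-cauchySchwarz f xs) ⟩
  f x * f x + (Q + length xs * f x * f x) + length xs * Q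
    ≡⟨ solve 3 (λ a Q n → a :* a :+ (Q :+ n :* a :* a) :+ n :* Q := (con 1 :+ n) :* (a :* a :+ Q)) refl (f x) Q (length xs) ⟩
  suc (length xs) * (f x * f x + Q) ∎
  where
  open ≤-Reasoning
  T = sumBy f xs
  Q = sumBy (λ x → f x * f x) xs
  cross-term : ∀ a ys → 2 * a * sumBy f ys ≤ sumBy (λ x → f x * f x) ys + length ys * a * a
  cross-term a [] = ≤-reflexive (*-zeroʳ (2 * a))
  cross-term a (y ∷ ys) = begin
    2 * a * (f y + sumBy f ys)
      ≡⟨ *-distribˡ-+ (2 * a) (f y) _ ⟩
    2 * a * f y + 2 * a * sumBy f ys
      ≤⟨ +-mono-≤ (2xy≤x²+y² a (f y)) (cross-term a ys) ⟩
    (a * a + f y * f y) + (R + length ys * a * a)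
      ≡⟨ solve 4 (λ a b R n → (a :* a :+ b :* b) :+ (R :+ n :* a :* a) := (b :* b :+ R) :+ (con 1 :+ n) :* a :* a)
           refl a (f y) R (length ys) ⟩
    (f y * f y + R) + suc (length ys) * a * a ∎
    where R = sumBy (λ x → f x * f x) ys

iverson : Bool → ℕ
iverson true = 1
iverson false = 0

iverson-∧ : ∀ a b → iverson (a ∧ b) ≡ iverson a * iverson b
iverson-∧ true b = sym (+-identityʳ (iverson b))
iverson-∧ false b = refl

length-filter-T? : ∀ (f : A → Bool) xs → length (filter (λ x → T? (f x)) xs) ≡ sumBy (iverson ∘ f) xs
length-filter-T? f [] = refl
length-filter-T? f (x ∷ xs) with f x
... | true = cong suc (length-filter-T? f xs)
... | false = length-filter-T? f xs

sumBy-words-suc : ∀ (h : List A → ℕ) S n →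
  sumBy h (words S (suc n)) ≡ sumBy (λ s → sumBy (λ w → h (s ∷ w)) (words S n)) S
sumBy-words-suc h S n = prepend-all S
  where
  prepend-all : ∀ T → sumBy h (concatMap (λ t → map (t ∷_) (words S n)) T) ≡ sumBy (λ t → sumBy (λ w → h (t ∷ w)) (words S n)) T
  prepend-all [] = refl
  prepend-all (t ∷ T) = trans (sumBy-++ h (map (t ∷_) (words S n)) _)
    (cong₂ _+_ (sumBy-map h (t ∷_) (words S n)) (prepend-all T))

length-words : ∀ (S : List A) n → length (words S n) ≡ length S ^ n
length-words S zero = refl
length-words S (suc n) = begin
  length (words S (suc n))                      ≡⟨ sym (*-identityʳ _) ⟩
  length (words S (suc n)) * 1                  ≡⟨ sym (sumBy-const (words S (suc n)) 1) ⟩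
  sumBy (λ _ → 1) (words S (suc n))             ≡⟨ sumBy-words-suc (λ _ → 1) S n ⟩
  sumBy (λ _ → sumBy (λ _ → 1) (words S n)) S   ≡⟨ sumBy-cong S (λ _ → trans (sumBy-const (words S n) 1) (*-identityʳ _)) ⟩
  sumBy (λ _ → length (words S n)) S            ≡⟨ sumBy-const S _ ⟩
  length S * length (words S n)                 ≡⟨ cong (length S *_) (length-words S n) ⟩
  length S * length S ^ n ∎
  where open ≡-Reasoning

sumᶠ prodᶠ : ∀ {d} → (Fin d → ℕ) → ℕ
sumᶠ {zero} f = 0
sumᶠ {suc d} f = f zero + sumᶠ (λ k → f (suc k))
prodᶠ {zero} f = 1
prodᶠ {suc d} f = f zero * prodᶠ (λ k → f (suc k))

sumᶠ-cong : ∀ {d} {f g : Fin d → ℕ} → (∀ k → f k ≡ g k) → sumᶠ f ≡ sumᶠ g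
sumᶠ-cong {zero} e = refl
sumᶠ-cong {suc d} e = cong₂ _+_ (e zero) (sumᶠ-cong (λ k → e (suc k)))

sumᶠ-mono : ∀ {d} {f g : Fin d → ℕ} → (∀ k → f k ≤ g k) → sumᶠ f ≤ sumᶠ g
sumᶠ-mono {zero} e = ≤-refl
sumᶠ-mono {suc d} e = +-mono-≤ (e zero) (sumᶠ-mono (λ k → e (suc k)))

sumᶠ-const : ∀ d c → sumᶠ {d} (λ _ → c) ≡ d * c
sumᶠ-const zero c = refl
sumᶠ-const (suc d) c = cong (c +_) (sumᶠ-const d c)

*-distribˡ-sumᶠ : ∀ {d} c (f : Fin d → ℕ) → c * sumᶠ f ≡ sumᶠ (λ k → c * f k)
*-distribˡ-sumᶠ {zero} c f = *-zeroʳ c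
*-distribˡ-sumᶠ {suc d} c f = trans (*-distribˡ-+ c (f zero) _) (cong (c * f zero +_) (*-distribˡ-sumᶠ c (λ k → f (suc k))))

≤sumᶠ : ∀ {d} (f : Fin d → ℕ) j → f j ≤ sumᶠ f
≤sumᶠ f zero = m≤m+n _ _
≤sumᶠ f (suc j) = ≤-trans (≤sumᶠ (λ k → f (suc k)) j) (m≤n+m _ (f zero))

sumBy-sumᶠ : ∀ {d} (xs : List A) (F : A → Fin d → ℕ) →
  sumBy (λ x → sumᶠ (F x)) xs ≡ sumᶠ (λ k → sumBy (λ x → F x k) xs)
sumBy-sumᶠ {d = zero} xs F = trans (sumBy-const xs 0) (*-zeroʳ (length xs))
sumBy-sumᶠ {d = suc d} xs F = trans (sumBy-+ xs (λ x → F x zero) (λ x → sumᶠ (λ k → F x (suc k))))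
  (cong (sumBy (λ x → F x zero) xs +_) (sumBy-sumᶠ xs (λ x k → F x (suc k))))

prodᶠ-cong : ∀ {d} {f g : Fin d → ℕ} → (∀ k → f k ≡ g k) → prodᶠ f ≡ prodᶠ g
prodᶠ-cong {zero} e = refl
prodᶠ-cong {suc d} e = cong₂ _*_ (e zero) (prodᶠ-cong (λ k → e (suc k)))

prodᶠ-mono : ∀ {d} {f g : Fin d → ℕ} → (∀ k → f k ≤ g k) → prodᶠ f ≤ prodᶠ g
prodᶠ-mono {zero} e = ≤-refl
prodᶠ-mono {suc d} e = *-mono-≤ (e zero) (prodᶠ-mono (λ k → e (suc k)))

prodᶠ-const : ∀ d c → prodᶠ {d} (λ _ → c) ≡ c ^ d
prodᶠ-const zero c = refl
prodᶠ-const (suc d) c = cong (c *_) (prodᶠ-const d c)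

prodᶠ-* : ∀ {d} (f g : Fin d → ℕ) → prodᶠ (λ k → f k * g k) ≡ prodᶠ f * prodᶠ g
prodᶠ-* {zero} f g = refl
prodᶠ-* {suc d} f g = trans (cong (f zero * g zero *_) (prodᶠ-* (λ k → f (suc k)) (λ k → g (suc k))))
  (solve 4 (λ a b x y → a :* b :* (x :* y) := a :* x :* (b :* y)) refl (f zero) (g zero) _ _)

prodᶠ-+-at : ∀ {d} (j : Fin d) c {f g h : Fin d → ℕ} →
  (∀ k → k ≢ j → f k ≡ h k) → (∀ k → k ≢ j → g k ≡ h k) → f j + g j ≡ c * h j →
  prodᶠ f + prodᶠ g ≡ c * prodᶠ h
prodᶠ-+-at {suc d} zero c {f} {g} {h} f≈h g≈h on = begin
  f zero * prodᶠ f′ + g zero * prodᶠ g′ ≡⟨ cong₂ (λ p q → f zero * p + g zero * q) (prodᶠ-cong f′≈h′) (prodᶠ-cong g′≈h′) ⟩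
  f zero * prodᶠ h′ + g zero * prodᶠ h′ ≡⟨ sym (*-distribʳ-+ (prodᶠ h′) (f zero) (g zero)) ⟩
  (f zero + g zero) * prodᶠ h′           ≡⟨ cong (_* prodᶠ h′) on ⟩
  c * h zero * prodᶠ h′                  ≡⟨ *-assoc c (h zero) _ ⟩
  c * (h zero * prodᶠ h′) ∎
  where
  open ≡-Reasoning
  f′ g′ h′ : Fin d → ℕ
  f′ k = f (suc k)
  g′ k = g (suc k)
  h′ k = h (suc k)
  f′≈h′ : ∀ k → f′ k ≡ h′ k
  f′≈h′ k = f≈h (suc k) (λ ())
  g′≈h′ : ∀ k → g′ k ≡ h′ k
  g′≈h′ k = g≈h (suc k) (λ ())
prodᶠ-+-at {suc d} (suc j) c {f} {g} {h} f≈h g≈h on = begin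
  f zero * prodᶠ f′ + g zero * prodᶠ g′ ≡⟨ cong₂ (λ a b → a * prodᶠ f′ + b * prodᶠ g′) (f≈h zero (λ ())) (g≈h zero (λ ())) ⟩
  h zero * prodᶠ f′ + h zero * prodᶠ g′ ≡⟨ sym (*-distribˡ-+ (h zero) _ _) ⟩
  h zero * (prodᶠ f′ + prodᶠ g′)        ≡⟨ cong (h zero *_) (prodᶠ-+-at j c (off f≈h) (off g≈h) on) ⟩
  h zero * (c * prodᶠ h′)               ≡⟨ solve 3 (λ a c p → a :* (c :* p) := c :* (a :* p)) refl (h zero) c (prodᶠ h′) ⟩
  c * (h zero * prodᶠ h′) ∎
  where
  open ≡-Reasoning
  f′ g′ h′ : Fin d → ℕ
  f′ k = f (suc k)
  g′ k = g (suc k)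
  h′ k = h (suc k)
  off : ∀ {e : Fin (suc d) → ℕ} → (∀ k → k ≢ suc j → e k ≡ h k) → ∀ k → k ≢ j → e (suc k) ≡ h′ k
  off e≈h k k≢j = e≈h (suc k) (k≢j ∘ Fin.suc-injective)

argmax : ∀ {d} (y : Fin (suc d) → ℕ) → Σ (Fin (suc d)) (λ j → ∀ k → y k ≤ y j)
argmax {zero} y = zero , λ { zero → ≤-refl }
argmax {suc d} y with argmax (λ k → y (suc k))
... | j , max with ≤-total (y zero) (y (suc j))
... | inj₁ y0≤ = suc j , λ { zero → y0≤ ; (suc k) → max k }
... | inj₂ ≥y0 = zero , λ { zero → ≤-refl ; (suc k) → ≤-trans (max k) ≥y0 }

-- A crude AM-GM inequality, through the largest factor.
prodᶠ≤sumᶠ-^ : ∀ {d} (y : Fin (suc d) → ℕ) → prodᶠ y ≤ sumᶠ (λ k → y k ^ suc d)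
prodᶠ≤sumᶠ-^ {d} y with argmax y
... | j , max = begin
  prodᶠ y                        ≤⟨ prodᶠ-mono max ⟩
  prodᶠ {suc d} (λ _ → y j)      ≡⟨ prodᶠ-const (suc d) (y j) ⟩
  y j ^ suc d                    ≤⟨ ≤sumᶠ (λ k → y k ^ suc d) j ⟩
  sumᶠ (λ k → y k ^ suc d) ∎
  where open ≤-Reasoning

-- walks⁺ a m and walks a m count ±1 walks of length m from a to 0, the first staying in ℕ and
-- the second unrestricted; a walk leaving 0 goes to 1 or, symmetrically, to -1.
walks⁺ walks : ℕ → ℕ → ℕ
walks⁺ zero zero = 1
walks⁺ (suc a) zero = 0
walks⁺ zero (suc m) = walks⁺ 1 m
walks⁺ (suc b) (suc m) = walks⁺ (suc (suc b)) m + walks⁺ b m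
walks zero zero = 1
walks (suc a) zero = 0
walks zero (suc m) = 2 * walks 1 m
walks (suc b) (suc m) = walks (suc (suc b)) m + walks b m

-- Reflection principle: walks from a that hit -1 are, after reflecting their initial part, the
-- walks from -2 - a, whose number is that of the walks from 2 + a.
walks⁺+walks-reflected : ∀ m a → walks⁺ a m + walks (2 + a) m ≡ walks a m
walks⁺+walks-reflected zero zero = refl
walks⁺+walks-reflected zero (suc a) = refl
walks⁺+walks-reflected (suc m) zero = begin
  walks⁺ 1 m + (walks 3 m + walks 1 m)   ≡⟨ sym (+-assoc (walks⁺ 1 m) _ _) ⟩
  (walks⁺ 1 m + walks 3 m) + walks 1 m   ≡⟨ cong (_+ walks 1 m) (walks⁺+walks-reflected m 1) ⟩
  walks 1 m + walks 1 m                  ≡⟨ cong (walks 1 m +_) (sym (+-identityʳ (walks 1 m))) ⟩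
  2 * walks 1 m ∎
  where open ≡-Reasoning
walks⁺+walks-reflected (suc m) (suc b) = begin
  (walks⁺ (2 + b) m + walks⁺ b m) + (walks (4 + b) m + walks (2 + b) m)
    ≡⟨ solve 4 (λ a b c d → (a :+ b) :+ (c :+ d) := (a :+ c) :+ (b :+ d)) refl
         (walks⁺ (2 + b) m) (walks⁺ b m) (walks (4 + b) m) (walks (2 + b) m) ⟩
  (walks⁺ (2 + b) m + walks (4 + b) m) + (walks⁺ b m + walks (2 + b) m)
    ≡⟨ cong₂ _+_ (walks⁺+walks-reflected m (2 + b)) (walks⁺+walks-reflected m b) ⟩
  walks (2 + b) m + walks b m ∎
  where open ≡-Reasoning

walks-too-far : ∀ m k → walks (suc (m + k)) m ≡ 0
walks-too-far zero k = refl
walks-too-far (suc m) k = begin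
  walks (3 + (m + k)) m + walks (suc (m + k)) m
    ≡⟨ cong (λ z → walks (suc z) m + walks (suc (m + k)) m) (sym (trans (+-suc m (suc k)) (cong suc (+-suc m k)))) ⟩
  walks (suc (m + (2 + k))) m + walks (suc (m + k)) m
    ≡⟨ cong₂ _+_ (walks-too-far m (2 + k)) (walks-too-far m k) ⟩
  0 ∎
  where open ≡-Reasoning

walks-straight : ∀ a → walks a a ≡ 1
walks-straight zero = refl
walks-straight (suc b) =
  cong₂ _+_ (trans (cong (λ z → walks (suc z) b) (+-comm 1 b)) (walks-too-far b 1)) (walks-straight b)

binomial : ℕ → ℕ → ℕ
binomial zero v = 1
binomial (suc u) zero = 1
binomial (suc u) (suc v) = binomial u (suc v) + binomial (suc u) v

binomial-comm : ∀ u v → binomial u v ≡ binomial v u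
binomial-comm zero zero = refl
binomial-comm zero (suc v) = refl
binomial-comm (suc u) zero = refl
binomial-comm (suc u) (suc v) = trans (cong₂ _+_ (binomial-comm u (suc v)) (binomial-comm (suc u) v))
  (+-comm (binomial (suc v) u) _)

binomial-factorial : ∀ u v → binomial u v * (u ! * v !) ≡ (u + v) !
binomial-factorial zero v = trans (+-identityʳ _) (+-identityʳ _)
binomial-factorial (suc u) zero = trans (*-identityˡ _) (trans (*-identityʳ _) (cong _! (sym (+-identityʳ (suc u)))))
binomial-factorial (suc u) (suc v) = begin
  (X + Y) * ((suc u * F) * (suc v * H))
    ≡⟨ solve 6 (λ X Y F H u v → (X :+ Y) :* (((con 1 :+ u) :* F) :* ((con 1 :+ v) :* H)) :=
         (con 1 :+ u) :* (X :* (F :* ((con 1 :+ v) :* H))) :+ (con 1 :+ v) :* (Y :* (((con 1 :+ u) :* F) :* H))) refl X Y F H u v ⟩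
  suc u * (X * (F * (suc v * H))) + suc v * (Y * ((suc u * F) * H))
    ≡⟨ cong₂ (λ p q → suc u * p + suc v * q) (binomial-factorial u (suc v))
         (trans (binomial-factorial (suc u) v) (cong _! (sym (+-suc u v)))) ⟩
  suc u * T + suc v * T
    ≡⟨ sym (*-distribʳ-+ T (suc u) (suc v)) ⟩
  (suc u + suc v) * T ∎
  where
  open ≡-Reasoning
  X = binomial u (suc v)
  Y = binomial (suc u) v
  F = u !
  H = v !
  T = (u + suc v) !

binomial-sucˡ : ∀ u v → binomial (suc u) v * suc u ≡ suc (u + v) * binomial u v
binomial-sucˡ u v = *-cancelʳ-≡ _ _ (u ! * v !) {{u !* v !≢0}} (begin
  binomial (suc u) v * suc u * (u ! * v !)
    ≡⟨ solve 4 (λ x u F H → x :* (con 1 :+ u) :* (F :* H) := x :* (((con 1 :+ u) :* F) :* H)) refl (binomial (suc u) v) u (u !) (v !) ⟩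
  binomial (suc u) v * ((suc u) ! * v !)     ≡⟨ binomial-factorial (suc u) v ⟩
  suc (u + v) * (u + v) !                    ≡⟨ cong (suc (u + v) *_) (sym (binomial-factorial u v)) ⟩
  suc (u + v) * (binomial u v * (u ! * v !)) ≡⟨ sym (*-assoc (suc (u + v)) (binomial u v) _) ⟩
  suc (u + v) * binomial u v * (u ! * v !) ∎)
  where open ≡-Reasoning

binomial-sucʳ : ∀ u v → binomial u (suc v) * suc v ≡ suc (u + v) * binomial u v
binomial-sucʳ u v = trans (cong (_* suc v) (binomial-comm u (suc v)))
  (trans (binomial-sucˡ v u) (cong₂ _*_ (cong suc (+-comm v u)) (binomial-comm v u)))

central-binomial-suc : ∀ j → binomial (suc j) (suc j) * suc j ≡ 2 * suc (j + j) * binomial j j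
central-binomial-suc j = *-cancelʳ-≡ _ _ (suc j) (begin
  binomial (suc j) (suc j) * suc j * suc j       ≡⟨ cong (_* suc j) (binomial-sucˡ j (suc j)) ⟩
  suc (j + suc j) * binomial j (suc j) * suc j   ≡⟨ *-assoc (suc (j + suc j)) (binomial j (suc j)) (suc j) ⟩
  suc (j + suc j) * (binomial j (suc j) * suc j) ≡⟨ cong₂ (λ a b → suc a * b) (+-suc j j) (binomial-sucʳ j j) ⟩
  suc (suc (j + j)) * (suc (j + j) * binomial j j)
    ≡⟨ solve 2 (λ j b → (con 2 :+ (j :+ j)) :* ((con 1 :+ (j :+ j)) :* b) := con 2 :* (con 1 :+ (j :+ j)) :* b :* (con 1 :+ j)) refl j (binomial j j) ⟩
  2 * suc (j + j) * binomial j j * suc j ∎)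
  where open ≡-Reasoning

central-binomial-bound : ∀ j → binomial j j * binomial j j * (3 * j + 1) ≤ 16 ^ j
central-binomial-bound zero = ≤-refl
central-binomial-bound (suc j) = *-cancelʳ-≤ _ _ (suc j * suc j) (begin
  b′ * b′ * (3 * suc j + 1) * (suc j * suc j)
    ≡⟨ solve 3 (λ x s j → x :* x :* (con 3 :* s :+ con 1) :* (s :* s) := (x :* s) :* (x :* s) :* (con 3 :* s :+ con 1)) refl b′ (suc j) j ⟩
  (b′ * suc j) * (b′ * suc j) * (3 * suc j + 1)
    ≡⟨ cong (λ z → z * z * (3 * suc j + 1)) (central-binomial-suc j) ⟩
  (2 * suc (j + j) * b) * (2 * suc (j + j) * b) * (3 * suc j + 1)
    ≡⟨ solve 2 (λ j b → (con 2 :* (con 1 :+ (j :+ j)) :* b) :* (con 2 :* (con 1 :+ (j :+ j)) :* b) :* (con 3 :* (con 1 :+ j) :+ con 1)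
          := b :* b :* (con 4 :* (con 1 :+ (j :+ j)) :* (con 1 :+ (j :+ j)) :* (con 3 :* j :+ con 4))) refl j b ⟩
  b * b * (4 * suc (j + j) * suc (j + j) * (3 * j + 4))
    ≤⟨ m≤m+n _ (4 * j * (b * b)) ⟩
  b * b * (4 * suc (j + j) * suc (j + j) * (3 * j + 4)) + 4 * j * (b * b)
    ≡⟨ solve 2 (λ j b → b :* b :* (con 4 :* (con 1 :+ (j :+ j)) :* (con 1 :+ (j :+ j)) :* (con 3 :* j :+ con 4)) :+ con 4 :* j :* (b :* b)
          := con 16 :* (b :* b :* (con 3 :* j :+ con 1)) :* ((con 1 :+ j) :* (con 1 :+ j))) refl j b ⟩
  16 * (b * b * (3 * j + 1)) * (suc j * suc j)
    ≤⟨ *-monoˡ-≤ (suc j * suc j) (*-monoʳ-≤ 16 (central-binomial-bound j)) ⟩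
  16 * 16 ^ j * (suc j * suc j) ∎)
  where
  open ≤-Reasoning
  b = binomial j j
  b′ = binomial (suc j) (suc j)

+-suc-suc : ∀ b u → b + (suc u + suc u) ≡ 2 + (b + (u + u))
+-suc-suc = solve 2 (λ b u → b :+ ((con 1 :+ u) :+ (con 1 :+ u)) := con 2 :+ (b :+ (u :+ u))) refl

walks-binomial : ∀ u a → walks a (a + (u + u)) ≡ binomial u (a + u)
walks-binomial zero a = trans (cong (walks a) (+-identityʳ a)) (walks-straight a)
walks-binomial (suc u) zero = begin
  2 * walks 1 (u + suc u)              ≡⟨ cong (λ z → 2 * walks 1 z) (+-suc u u) ⟩
  2 * walks 1 (suc (u + u))            ≡⟨ cong (2 *_) (walks-binomial u 1) ⟩
  2 * binomial u (suc u)               ≡⟨ cong (binomial u (suc u) +_) (trans (+-identityʳ _) (binomial-comm u (suc u))) ⟩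
  binomial u (suc u) + binomial (suc u) u ∎
  where open ≡-Reasoning
walks-binomial (suc u) (suc b) = begin
  walks (2 + b) (b + (suc u + suc u)) + walks b (b + (suc u + suc u))
    ≡⟨ cong₂ _+_ (trans (cong (walks (2 + b)) (+-suc-suc b u)) (walks-binomial u (2 + b))) (walks-binomial (suc u) b) ⟩
  binomial u (2 + (b + u)) + binomial (suc u) (b + suc u)
    ≡⟨ cong (λ z → binomial u (suc z) + binomial (suc u) (b + suc u)) (sym (+-suc b u)) ⟩
  binomial u (suc (b + suc u)) + binomial (suc u) (b + suc u) ∎
  where open ≡-Reasoning

walks-parity : ∀ u a → walks a (suc (a + (u + u))) ≡ 0
walks-parity zero zero = refl
walks-parity zero (suc b) = cong₂ _+_ too-far (walks-parity zero b)
  where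
  too-far : walks (2 + b) (suc (b + 0)) ≡ 0
  too-far = trans (cong (λ z → walks (2 + b) (suc z)) (+-identityʳ b))
    (subst (λ z → walks (2 + z) (suc b) ≡ 0) (+-identityʳ b) (walks-too-far (suc b) 0))
walks-parity (suc u) zero = trans (cong (λ z → 2 * walks 1 (suc z)) (+-suc u u)) (cong (2 *_) (walks-parity u 1))
walks-parity (suc u) (suc b) = cong₂ _+_
  (trans (cong (λ z → walks (2 + b) (suc z)) (+-suc-suc b u)) (walks-parity u (2 + b)))
  (walks-parity (suc u) b)

excursions-catalan : ∀ j → walks⁺ 0 (j + j) * suc j ≡ binomial j j
excursions-catalan zero = refl
excursions-catalan (suc j) = +-cancelʳ-≡ (suc j * b) _ _ (begin
  e * (2 + j) + suc j * b       ≡⟨ cong (e * (2 + j) +_) (sym reflected-count) ⟩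
  e * (2 + j) + n * (2 + j)     ≡⟨ sym (*-distribʳ-+ (2 + j) e n) ⟩
  (e + n) * (2 + j)             ≡⟨ cong (_* (2 + j)) (trans (walks⁺+walks-reflected m 0) (walks-binomial (suc j) 0)) ⟩
  b * (2 + j)                   ≡⟨ *-comm b (2 + j) ⟩
  b + suc j * b ∎)
  where
  open ≡-Reasoning
  m = suc j + suc j
  e = walks⁺ 0 m
  n = walks 2 m
  b = binomial (suc j) (suc j)
  reflected-count : n * (2 + j) ≡ suc j * b
  reflected-count = begin
    walks 2 m * (2 + j)                     ≡⟨ cong (λ z → walks 2 z * (2 + j)) (+-suc (suc j) j) ⟩
    walks 2 (2 + (j + j)) * (2 + j)         ≡⟨ cong (_* (2 + j)) (walks-binomial j 2) ⟩
    binomial j (2 + j) * (2 + j)            ≡⟨ binomial-sucʳ j (suc j) ⟩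
    suc (j + suc j) * binomial j (suc j)    ≡⟨ sym (binomial-sucˡ j (suc j)) ⟩
    b * suc j                               ≡⟨ *-comm b (suc j) ⟩
    suc j * b ∎

excursions-odd : ∀ j → walks⁺ 0 (suc (j + j)) ≡ 0
excursions-odd j = m+n≡0⇒m≡0 _ (trans (walks⁺+walks-reflected (suc (j + j)) 0) (walks-parity j 0))

even-or-odd : ∀ m → Σ ℕ (λ j → m ≡ j + j ⊎ m ≡ suc (j + j))
even-or-odd zero = 0 , inj₁ refl
even-or-odd (suc m) with even-or-odd m
... | j , inj₁ refl = j , inj₂ refl
... | j , inj₂ refl = suc j , inj₁ (cong suc (sym (+-suc j j)))

excursions-bound : ∀ m → walks⁺ 0 m * walks⁺ 0 m * (suc m * suc m * suc m) ≤ 3 * 4 ^ m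
excursions-bound m with even-or-odd m
... | j , inj₂ refl rewrite excursions-odd j = z≤n
... | j , inj₁ refl = begin
  e * e * (suc (j + j) * suc (j + j) * suc (j + j))
    ≤⟨ *-monoʳ-≤ (e * e) cubic ⟩
  e * e * (3 * (suc j * suc j) * (3 * j + 1))
    ≡⟨ solve 3 (λ e s j → e :* e :* (con 3 :* (s :* s) :* (con 3 :* j :+ con 1)) := con 3 :* ((e :* s) :* (e :* s) :* (con 3 :* j :+ con 1))) refl e (suc j) j ⟩
  3 * ((e * suc j) * (e * suc j) * (3 * j + 1))
    ≡⟨ cong (λ z → 3 * (z * z * (3 * j + 1))) (excursions-catalan j) ⟩
  3 * (binomial j j * binomial j j * (3 * j + 1))
    ≤⟨ *-monoʳ-≤ 3 (central-binomial-bound j) ⟩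
  3 * 16 ^ j
    ≡⟨ cong (3 *_) (trans (*-^-distrib 4 4 j) (sym (^-distribˡ-+-* 4 j j))) ⟩
  3 * 4 ^ (j + j) ∎
  where
  open ≤-Reasoning
  e = walks⁺ 0 (j + j)
  cubic : suc (j + j) * suc (j + j) * suc (j + j) ≤ 3 * (suc j * suc j) * (3 * j + 1)
  cubic = subst (suc (j + j) * suc (j + j) * suc (j + j) ≤_)
    (solve 1 (λ j → (con 1 :+ (j :+ j)) :* (con 1 :+ (j :+ j)) :* (con 1 :+ (j :+ j)) :+ (j :* j :* j :+ con 9 :* j :* j :+ con 9 :* j :+ con 2)
                  := con 3 :* ((con 1 :+ j) :* (con 1 :+ j)) :* (con 3 :* j :+ con 1)) refl j)
    (m≤m+n _ _)

rising : ℕ → ℕ → ℕ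
rising x zero = 1
rising x (suc r) = x * rising (suc x) r

rising≤^ : ∀ r x → rising x r ≤ (x + r) ^ r
rising≤^ zero x = ≤-refl
rising≤^ (suc r) x = *-mono-≤ (m≤m+n x (suc r)) (subst (λ z → rising (suc x) r ≤ z ^ r) (sym (+-suc x r)) (rising≤^ r (suc x)))

^≤rising : ∀ r {x y} → x ≤ y → x ^ r ≤ rising y r
^≤rising zero x≤y = ≤-refl
^≤rising (suc r) x≤y = *-mono-≤ x≤y (^≤rising r (m≤n⇒m≤1+n x≤y))

-- Ω n g = Σ_{m + z = n} (n choose m) α^m β^z g m z.
module BinomialTransform (α β : ℕ) where

  Ω : ℕ → (ℕ → ℕ → ℕ) → ℕ
  Ω zero g = g 0 0
  Ω (suc n) g = α * Ω n (λ m z → g (suc m) z) + β * Ω n (λ m z → g m (suc z))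

  Ω-cong : ∀ n {g h : ℕ → ℕ → ℕ} → (∀ m z → g m z ≡ h m z) → Ω n g ≡ Ω n h
  Ω-cong zero e = e 0 0
  Ω-cong (suc n) e = cong₂ (λ p q → α * p + β * q) (Ω-cong n (λ m z → e (suc m) z)) (Ω-cong n (λ m z → e m (suc z)))

  Ω-mono : ∀ n {g h : ℕ → ℕ → ℕ} → (∀ m z → m + z ≡ n → g m z ≤ h m z) → Ω n g ≤ Ω n h
  Ω-mono zero e = e 0 0 refl
  Ω-mono (suc n) e = +-mono-≤ (*-monoʳ-≤ α (Ω-mono n (λ m z eq → e (suc m) z (cong suc eq))))
                              (*-monoʳ-≤ β (Ω-mono n (λ m z eq → e m (suc z) (trans (+-suc m z) (cong suc eq)))))

  Ω-+ : ∀ n (g h : ℕ → ℕ → ℕ) → Ω n (λ m z → g m z + h m z) ≡ Ω n g + Ω n h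
  Ω-+ zero g h = refl
  Ω-+ (suc n) g h = begin
    α * Ω n (λ m z → g (suc m) z + h (suc m) z) + β * Ω n (λ m z → g m (suc z) + h m (suc z))
      ≡⟨ cong₂ (λ p q → α * p + β * q) (Ω-+ n _ _) (Ω-+ n _ _) ⟩
    α * (G₁ + H₁) + β * (G₂ + H₂)
      ≡⟨ solve 6 (λ α β a b c d → α :* (a :+ b) :+ β :* (c :+ d) := (α :* a :+ β :* c) :+ (α :* b :+ β :* d)) refl α β G₁ H₁ G₂ H₂ ⟩
    (α * G₁ + β * G₂) + (α * H₁ + β * H₂) ∎
    where
    open ≡-Reasoning
    G₁ = Ω n (λ m z → g (suc m) z)
    H₁ = Ω n (λ m z → h (suc m) z)
    G₂ = Ω n (λ m z → g m (suc z))
    H₂ = Ω n (λ m z → h m (suc z))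

  Ω-const : ∀ n M → Ω n (λ _ _ → M) ≡ M * (α + β) ^ n
  Ω-const zero M = sym (*-identityʳ M)
  Ω-const (suc n) M = begin
    α * Ω n (λ _ _ → M) + β * Ω n (λ _ _ → M)       ≡⟨ cong₂ (λ p q → α * p + β * q) (Ω-const n M) (Ω-const n M) ⟩
    α * (M * (α + β) ^ n) + β * (M * (α + β) ^ n)
      ≡⟨ solve 4 (λ α β M P → α :* (M :* P) :+ β :* (M :* P) := M :* ((α :+ β) :* P)) refl α β M ((α + β) ^ n) ⟩
    M * ((α + β) * (α + β) ^ n) ∎
    where open ≡-Reasoning

  -- The transform of m (n + 1 choose m) = (n + 1) (n choose m - 1).
  Ω-shift : ∀ n (f : ℕ → ℕ → ℕ) → α * suc n * Ω n f ≡ Ω (suc n) (λ m z → m * f (m ∸ 1) z)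
  Ω-shift zero f = trans (solve 2 (λ α x → α :* con 1 :* x := α :* (x :+ con 0) :+ con 0) refl α (f 0 0))
    (cong (α * (f 0 0 + 0) +_) (sym (*-zeroʳ β)))
  Ω-shift (suc n) f = sym (begin
    α * Ω (suc n) (λ m z → suc m * f m z) + β * Ω (suc n) (λ m z → m * f (m ∸ 1) (suc z))
      ≡⟨ cong₂ (λ p q → α * p + β * q) moved (sym (Ω-shift n (λ m z → f m (suc z)))) ⟩
    α * (X + α * suc n * Fm) + β * (α * suc n * Fz)
      ≡⟨ solve 6 (λ α β s X A B → α :* (X :+ α :* s :* A) :+ β :* (α :* s :* B) := α :* X :+ α :* s :* (α :* A :+ β :* B))
           refl α β (suc n) X Fm Fz ⟩
    α * X + α * suc n * X
      ≡⟨ solve 3 (λ α s X → α :* X :+ α :* s :* X := α :* (con 1 :+ s) :* X) refl α (suc n) X ⟩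
    α * (2 + n) * X ∎)
    where
    open ≡-Reasoning
    X = Ω (suc n) f
    Fm = Ω n (λ m z → f (suc m) z)
    Fz = Ω n (λ m z → f m (suc z))
    moved : Ω (suc n) (λ m z → suc m * f m z) ≡ X + α * suc n * Fm
    moved = begin
      Ω (suc n) (λ m z → suc m * f m z)                       ≡⟨ Ω-cong (suc n) split ⟩
      Ω (suc n) (λ m z → f m z + m * f (suc (m ∸ 1)) z)       ≡⟨ Ω-+ (suc n) f (λ m z → m * f (suc (m ∸ 1)) z) ⟩
      X + Ω (suc n) (λ m z → m * f (suc (m ∸ 1)) z)           ≡⟨ cong (X +_) (sym (Ω-shift n (λ m z → f (suc m) z))) ⟩
      X + α * suc n * Fm ∎
      where
      split : ∀ m z → suc m * f m z ≡ f m z + m * f (suc (m ∸ 1)) z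
      split zero z = refl
      split (suc m) z = refl

  -- Iterating Ω-shift r times turns the factor α^r (n + 1)⋯(n + r) into the weight (m + 1)⋯(m + r).
  Ω-rising-bound : ∀ r n (g : ℕ → ℕ → ℕ) M → (∀ m z → m + z ≡ n → g m z * rising (suc m) r ≤ M) →
                   Ω n g * α ^ r * rising (suc n) r ≤ M * (α + β) ^ (n + r)
  Ω-rising-bound zero n g M bounded = begin
    Ω n g * 1 * 1           ≡⟨ trans (*-identityʳ _) (*-identityʳ _) ⟩
    Ω n g                   ≤⟨ Ω-mono n (λ m z eq → subst (_≤ M) (*-identityʳ (g m z)) (bounded m z eq)) ⟩
    Ω n (λ _ _ → M)         ≡⟨ Ω-const n M ⟩
    M * (α + β) ^ n         ≡⟨ cong (λ k → M * (α + β) ^ k) (sym (+-identityʳ n)) ⟩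
    M * (α + β) ^ (n + 0) ∎
    where open ≤-Reasoning
  Ω-rising-bound (suc r) n g M bounded = begin
    Ω n g * (α * α ^ r) * (suc n * rising (2 + n) r)
      ≡⟨ solve 5 (λ X α A s R → X :* (α :* A) :* (s :* R) := (α :* s :* X) :* A :* R) refl (Ω n g) α (α ^ r) (suc n) (rising (2 + n) r) ⟩
    (α * suc n * Ω n g) * α ^ r * rising (2 + n) r
      ≡⟨ cong (λ z → z * α ^ r * rising (2 + n) r) (Ω-shift n g) ⟩
    Ω (suc n) g′ * α ^ r * rising (2 + n) r
      ≤⟨ Ω-rising-bound r (suc n) g′ M bounded′ ⟩
    M * (α + β) ^ (suc n + r)
      ≡⟨ cong (λ k → M * (α + β) ^ k) (sym (+-suc n r)) ⟩
    M * (α + β) ^ (n + suc r) ∎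
    where
    open ≤-Reasoning
    g′ : ℕ → ℕ → ℕ
    g′ m z = m * g (m ∸ 1) z
    bounded′ : ∀ m z → m + z ≡ suc n → g′ m z * rising (suc m) r ≤ M
    bounded′ zero z eq = z≤n
    bounded′ (suc m) z eq = subst (_≤ M)
      (solve 3 (λ s G R → G :* (s :* R) := s :* G :* R) refl (suc m) (g m z) (rising (2 + m) r))
      (bounded m z (suc-injective eq))

flipAt : ∀ {d} → Fin d → Pt d → Pt d
flipAt k s = s [ k ]≔ (- lookup s k)

flipAt-involutive : ∀ {d} (k : Fin d) s → flipAt k (flipAt k s) ≡ s
flipAt-involutive k s = begin
  (s [ k ]≔ (- lookup s k)) [ k ]≔ (- lookup (s [ k ]≔ (- lookup s k)) k)
    ≡⟨ cong (λ z → (s [ k ]≔ (- lookup s k)) [ k ]≔ (- z)) (lookup∘update k s _) ⟩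
  (s [ k ]≔ (- lookup s k)) [ k ]≔ (- (- lookup s k))
    ≡⟨ []≔-idempotent s k ⟩
  s [ k ]≔ (- (- lookup s k))
    ≡⟨ cong (s [ k ]≔_) (neg-involutive (lookup s k)) ⟩
  s [ k ]≔ lookup s k
    ≡⟨ []≔-lookup s k ⟩
  s ∎
  where open ≡-Reasoning

flipAt-injective : ∀ {d} (k : Fin d) {s t} → flipAt k s ≡ flipAt k t → s ≡ t
flipAt-injective k {s} {t} eq =
  trans (sym (flipAt-involutive k s)) (trans (cong (flipAt k) eq) (flipAt-involutive k t))

module _ {d} {S : List (Pt d)} (unique : Unique S) (symmetric : AxisSymmetric S) (k : Fin d) where

  map-flipAt-↭ : map (flipAt k) S ↭ S
  map-flipAt-↭ = ∼bag⇒↭ (unique∧set⇒bag (Unique.map⁺ (flipAt-injective k) unique) unique (mk⇔ to from))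
    where
    to : ∀ {s} → s ∈ map (flipAt k) S → s ∈ S
    to s∈ with ∈-map⁻ (flipAt k) s∈
    ... | t , t∈S , refl = symmetric t∈S k
    from : ∀ {s} → s ∈ S → s ∈ map (flipAt k) S
    from {s} s∈S = subst (_∈ map (flipAt k) S) (flipAt-involutive k s) (∈-map⁺ (flipAt k) (symmetric s∈S k))

  sumBy-flipAt : ∀ (f : Pt d → ℕ) → sumBy (f ∘ flipAt k) S ≡ sumBy f S
  sumBy-flipAt f = trans (sym (sumBy-map f (flipAt k) S)) (sumBy-↭ f map-flipAt-↭)

IsUnit : ℤ → Set
IsUnit x = x ≡ -1ℤ ⊎ x ≡ 0ℤ ⊎ x ≡ 1ℤ

weight : ∀ {d} → (Fin d → ℤ → ℕ) → Pt d → ℕ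
weight F s = prodᶠ (λ k → F k (lookup s k))

module Symmetrization {d} (S : List (Pt d)) (unique : Unique S) (symmetric : AxisSymmetric S)
                      (unit : ∀ {s} → s ∈ S → ∀ k → IsUnit (lookup s k)) where

  sumBy-weight-symmetrizeAt : ∀ j (F G : Fin d → ℤ → ℕ) → (∀ k → k ≢ j → ∀ x → F k x ≡ G k x) →
    (∀ x → IsUnit x → F j x + F j (- x) ≡ 2 * G j x) → sumBy (weight F) S ≡ sumBy (weight G) S
  sumBy-weight-symmetrizeAt j F G off on = *-cancelˡ-≡ _ _ 2 (begin
    2 * sumBy (weight F) S                           ≡⟨ cong (sumBy (weight F) S +_) (+-identityʳ _) ⟩
    sumBy (weight F) S + sumBy (weight F) S          ≡⟨ cong (sumBy (weight F) S +_) (sym (sumBy-flipAt unique symmetric j (weight F))) ⟩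
    sumBy (weight F) S + sumBy (weight F ∘ flipAt j) S ≡⟨ sym (sumBy-+ S (weight F) (weight F ∘ flipAt j)) ⟩
    sumBy (λ s → weight F s + weight F (flipAt j s)) S ≡⟨ sumBy-cong∈ S paired ⟩
    sumBy (λ s → 2 * weight G s) S                   ≡⟨ sym (*-distribˡ-sumBy 2 S (weight G)) ⟩
    2 * sumBy (weight G) S ∎)
    where
    open ≡-Reasoning
    paired : ∀ {s} → s ∈ S → weight F s + weight F (flipAt j s) ≡ 2 * weight G s
    paired {s} s∈S = prodᶠ-+-at j 2 (λ k k≢j → off k k≢j (lookup s k))
      (λ k k≢j → trans (cong (F k) (lookup∘update′ k≢j s _)) (off k k≢j (lookup s k)))
      (trans (cong (λ x → F j (lookup s j) + F j x) (lookup∘update j s _)) (on (lookup s j) (unit s∈S j)))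

  module _ (L R : Fin d → ℤ → ℕ) (sym-LR : ∀ k x → IsUnit x → L k x + L k (- x) ≡ 2 * R k x) where

    hybrid : ℕ → Fin d → ℤ → ℕ
    hybrid i k x with toℕ k <? i
    ... | yes _ = R k x
    ... | no _ = L k x

    sumBy-weight-hybrid-suc : ∀ i → i < d → sumBy (weight (hybrid i)) S ≡ sumBy (weight (hybrid (suc i))) S
    sumBy-weight-hybrid-suc i i<d = sumBy-weight-symmetrizeAt j (hybrid i) (hybrid (suc i)) off on
      where
      j = fromℕ< i<d
      toℕ-j : toℕ j ≡ i
      toℕ-j = Fin.toℕ-fromℕ< i<d
      off : ∀ k → k ≢ j → ∀ x → hybrid i k x ≡ hybrid (suc i) k x
      off k k≢j x with toℕ k <? i | toℕ k <? suc i
      ... | yes _ | yes _ = refl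
      ... | no _ | no _ = refl
      ... | yes k<i | no k≮1+i = contradiction (m≤n⇒m≤1+n k<i) k≮1+i
      ... | no k≮i | yes k<1+i = contradiction (Fin.toℕ-injective (trans (≤-antisym (≤-pred k<1+i) (≮⇒≥ k≮i)) (sym toℕ-j))) k≢j
      on : ∀ x → IsUnit x → hybrid i j x + hybrid i j (- x) ≡ 2 * hybrid (suc i) j x
      on x x-unit with toℕ j <? i | toℕ j <? suc i
      ... | yes j<i | _ = contradiction (subst (_< i) toℕ-j j<i) (<-irrefl refl)
      ... | no _ | no j≮1+i = contradiction (subst (_< suc i) (sym toℕ-j) (n<1+n i)) j≮1+i
      ... | no _ | yes _ = sym-LR j x x-unit

    sumBy-weight-hybrid : ∀ i → i ≤ d → sumBy (weight L) S ≡ sumBy (weight (hybrid i)) S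
    sumBy-weight-hybrid zero _ = refl
    sumBy-weight-hybrid (suc i) i<d = trans (sumBy-weight-hybrid i (<⇒≤ i<d)) (sumBy-weight-hybrid-suc i i<d)

    sumBy-weight-symmetrize : sumBy (weight L) S ≡ sumBy (weight R) S
    sumBy-weight-symmetrize = trans (sumBy-weight-hybrid d ≤-refl) (sumBy-cong S (λ s → prodᶠ-cong (λ k → all-R (lookup s k) k)))
      where
      all-R : ∀ x k → hybrid d k x ≡ R k x
      all-R x k with toℕ k <? d
      ... | yes _ = refl
      ... | no k≮d = contradiction (Fin.toℕ<n k) k≮d

walksFrom⁺ : ℤ → ℕ → ℕ
walksFrom⁺ (ℤ.+ a) m = walks⁺ a m
walksFrom⁺ -[1+ _ ] m = 0

moves stays : ℤ → ℕ
moves x = if isZeroℤ x then 0 else 1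
stays x = if isZeroℤ x then 1 else 0

moves-stays : ∀ x → (moves x ≡ 0 × stays x ≡ 1) ⊎ (moves x ≡ 1 × stays x ≡ 0)
moves-stays x with isZeroℤ x
... | true = inj₁ (refl , refl)
... | false = inj₂ (refl , refl)

movesAlong staysAlong : ∀ {d} → Fin d → List (Pt d) → ℕ
movesAlong k [] = 0
movesAlong k (s ∷ w) = moves (lookup s k) + movesAlong k w
staysAlong k [] = 0
staysAlong k (s ∷ w) = stays (lookup s k) + staysAlong k w

-- Of the 2^(d n) ways to change the signs of the coordinates of the steps of w, decoupled p w
-- produce an excursion from p: along axis k the moving steps must form a walk in ℕ to 0 and the
-- signs of the resting ones are free. As S is axis symmetric, sign changes permute S^n.
decoupled : ∀ {d} → Pt d → List (Pt d) → ℕ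
decoupled p w = prodᶠ (λ k → walksFrom⁺ (lookup p k) (movesAlong k w) * 2 ^ staysAlong k w)

excursionsFrom : ∀ {d} → Pt d → List (List (Pt d)) → ℕ
excursionsFrom p W = sumBy (iverson ∘ excursionFrom p) W

walksFrom⁺-first-step : ∀ a m z x → IsUnit x →
  walksFrom⁺ (ℤ.+ a ℤ.+ x) m * 2 ^ z * 2 + walksFrom⁺ (ℤ.+ a ℤ.+ (- x)) m * 2 ^ z * 2 ≡
  2 * (walksFrom⁺ (ℤ.+ a) (moves x + m) * 2 ^ (stays x + z))
walksFrom⁺-first-step a m z x (inj₂ (inj₁ refl)) rewrite +-identityʳ a =
  solve 2 (λ e t → e :* t :* con 2 :+ e :* t :* con 2 := con 2 :* (e :* (con 2 :* t))) refl (walks⁺ a m) (2 ^ z)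
walksFrom⁺-first-step zero m z x (inj₂ (inj₂ refl)) =
  solve 2 (λ e t → e :* t :* con 2 :+ con 0 :* t :* con 2 := con 2 :* (e :* t)) refl (walks⁺ 1 m) (2 ^ z)
walksFrom⁺-first-step (suc b) m z x (inj₂ (inj₂ refl)) rewrite +-comm b 1 =
  solve 3 (λ e f t → e :* t :* con 2 :+ f :* t :* con 2 := con 2 :* ((e :+ f) :* t)) refl (walks⁺ (2 + b) m) (walks⁺ b m) (2 ^ z)
walksFrom⁺-first-step zero m z x (inj₁ refl) =
  solve 2 (λ e t → con 0 :* t :* con 2 :+ e :* t :* con 2 := con 2 :* (e :* t)) refl (walks⁺ 1 m) (2 ^ z)
walksFrom⁺-first-step (suc b) m z x (inj₁ refl) rewrite +-comm b 1 =
  solve 3 (λ e f t → f :* t :* con 2 :+ e :* t :* con 2 := con 2 :* ((e :+ f) :* t)) refl (walks⁺ (2 + b) m) (walks⁺ b m) (2 ^ z)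

iverson-isOrigin : ∀ {d} (p : Pt d) → iverson (isOrigin p) ≡ prodᶠ (λ k → walksFrom⁺ (lookup p k) 0 * 2 ^ 0)
iverson-isOrigin [] = refl
iverson-isOrigin (x ∷ p) = trans (iverson-∧ (isZeroℤ x) _) (cong₂ _*_ (at-origin x) (iverson-isOrigin p))
  where
  at-origin : ∀ x → iverson (isZeroℤ x) ≡ walksFrom⁺ x 0 * 1
  at-origin (ℤ.+ zero) = refl
  at-origin (ℤ.+ suc a) = refl
  at-origin -[1+ a ] = refl

walksFrom⁺-negative : ∀ x m → (0ℤ ℤ.≤ᵇ x) ≡ false → walksFrom⁺ x m ≡ 0
walksFrom⁺-negative -[1+ a ] m _ = refl

iverson-inOrthant-* : ∀ {d} (q : Pt d) (f : Fin d → ℕ) → (∀ k → (0ℤ ℤ.≤ᵇ lookup q k) ≡ false → f k ≡ 0) →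
  iverson (inOrthant q) * prodᶠ f ≡ prodᶠ f
iverson-inOrthant-* [] f vanish = refl
iverson-inOrthant-* (x ∷ q) f vanish with 0ℤ ℤ.≤ᵇ x in x≥0
... | true = trans (solve 3 (λ a b c → a :* (b :* c) := b :* (a :* c)) refl (iverson (inOrthant q)) (f zero) _)
  (cong (f zero *_) (iverson-inOrthant-* q (λ k → f (suc k)) (λ k → vanish (suc k))))
... | false = sym (cong (_* prodᶠ (λ k → f (suc k))) (vanish zero x≥0))

inOrthant⇒natural : ∀ {d} (p : Pt d) → inOrthant p ≡ true → ∀ k → Σ ℕ (λ a → lookup p k ≡ ℤ.+ a)
inOrthant⇒natural (x ∷ p) p≥0 k with 0ℤ ℤ.≤ᵇ x in x≥0
inOrthant⇒natural (ℤ.+ a ∷ p) p≥0 zero | true = a , refl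
inOrthant⇒natural (x ∷ p) p≥0 (suc k) | true = inOrthant⇒natural p p≥0 k

inOrthant-origin : ∀ d → inOrthant (origin {d}) ≡ true
inOrthant-origin zero = refl
inOrthant-origin (suc d) = inOrthant-origin d

iverson-*-cong : ∀ b {m n} → (b ≡ true → m ≡ n) → iverson b * m ≡ iverson b * n
iverson-*-cong true eq = cong (1 *_) (eq refl)
iverson-*-cong false eq = refl

stepWeight restWeight : ∀ {d} → Pt d → List (Pt d) → Fin d → ℤ → ℕ
stepWeight p w k x = walksFrom⁺ (lookup p k ℤ.+ x) (movesAlong k w) * 2 ^ staysAlong k w * 2
restWeight p w k x = walksFrom⁺ (lookup p k) (moves x + movesAlong k w) * 2 ^ (stays x + staysAlong k w)

iverson-inOrthant-decoupled : ∀ {d} (p s : Pt d) w →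
  iverson (inOrthant (p ⊕ s)) * (2 ^ d * decoupled (p ⊕ s) w) ≡ weight (stepWeight p w) s
iverson-inOrthant-decoupled {d} p s w = begin
  iverson (inOrthant q) * (2 ^ d * decoupled q w)
    ≡⟨ cong (iverson (inOrthant q) *_) (trans (*-comm (2 ^ d) _) (trans (cong (decoupled q w *_) (sym (prodᶠ-const d 2)))
         (sym (prodᶠ-* (λ k → walksFrom⁺ (lookup q k) (movesAlong k w) * 2 ^ staysAlong k w) (λ _ → 2))))) ⟩
  iverson (inOrthant q) * prodᶠ (λ k → walksFrom⁺ (lookup q k) (movesAlong k w) * 2 ^ staysAlong k w * 2)
    ≡⟨ iverson-inOrthant-* q _ (λ k qk<0 → cong (λ t → t * 2 ^ staysAlong k w * 2) (walksFrom⁺-negative (lookup q k) _ qk<0)) ⟩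
  prodᶠ (λ k → walksFrom⁺ (lookup q k) (movesAlong k w) * 2 ^ staysAlong k w * 2)
    ≡⟨ prodᶠ-cong (λ k → cong (λ t → walksFrom⁺ t (movesAlong k w) * 2 ^ staysAlong k w * 2) (lookup-zipWith ℤ._+_ k p s)) ⟩
  weight (stepWeight p w) s ∎
  where
  open ≡-Reasoning
  q = p ⊕ s

module Decoupling {d} (S : List (Pt d)) (unique : Unique S) (symmetric : AxisSymmetric S)
                  (unit : ∀ {s} → s ∈ S → ∀ k → IsUnit (lookup s k)) where

  open Symmetrization S unique symmetric unit

  sumBy-step≡sumBy-rest : ∀ p → inOrthant p ≡ true → ∀ w →
    sumBy (weight (stepWeight p w)) S ≡ sumBy (weight (restWeight p w)) S
  sumBy-step≡sumBy-rest p p≥0 w = sumBy-weight-symmetrize (stepWeight p w) (restWeight p w) first-step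
    where
    first-step : ∀ k x → IsUnit x → stepWeight p w k x + stepWeight p w k (- x) ≡ 2 * restWeight p w k x
    first-step k x x-unit with inOrthant⇒natural p p≥0 k
    ... | a , pk≡a rewrite pk≡a = walksFrom⁺-first-step a (movesAlong k w) (staysAlong k w) x x-unit

  excursions-decouple : ∀ n p → inOrthant p ≡ true →
    (2 ^ d) ^ n * excursionsFrom p (words S n) ≡ sumBy (decoupled p) (words S n)
  excursions-decouple zero p _ = trans (*-identityˡ _) (cong (_+ 0) (iverson-isOrigin p))
  excursions-decouple (suc n) p p≥0 = begin
    (2 ^ d) ^ suc n * excursionsFrom p (words S (suc n))
      ≡⟨ cong ((2 ^ d) ^ suc n *_) (sumBy-words-suc (iverson ∘ excursionFrom p) S n) ⟩
    (2 ^ d) ^ suc n * sumBy (λ s → sumBy (λ w → iverson (excursionFrom p (s ∷ w))) W) S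
      ≡⟨ *-distribˡ-sumBy ((2 ^ d) ^ suc n) S _ ⟩
    sumBy (λ s → (2 ^ d) ^ suc n * sumBy (λ w → iverson (excursionFrom p (s ∷ w))) W) S
      ≡⟨ sumBy-cong S first-steps ⟩
    sumBy (λ s → sumBy (λ w → weight (stepWeight p w) s) W) S
      ≡⟨ sumBy-comm S W (λ s w → weight (stepWeight p w) s) ⟩
    sumBy (λ w → sumBy (weight (stepWeight p w)) S) W
      ≡⟨ sumBy-cong W (sumBy-step≡sumBy-rest p p≥0) ⟩
    sumBy (λ w → sumBy (weight (restWeight p w)) S) W
      ≡⟨ sym (sumBy-comm S W (λ s w → decoupled p (s ∷ w))) ⟩
    sumBy (λ s → sumBy (λ w → decoupled p (s ∷ w)) W) S
      ≡⟨ sym (sumBy-words-suc (decoupled p) S n) ⟩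
    sumBy (decoupled p) (words S (suc n)) ∎
    where
    open ≡-Reasoning
    W = words S n
    first-steps : ∀ s → (2 ^ d) ^ suc n * sumBy (λ w → iverson (excursionFrom p (s ∷ w))) W ≡ sumBy (λ w → weight (stepWeight p w) s) W
    first-steps s = begin
      (2 ^ d) ^ suc n * sumBy (λ w → iverson (inOrthant q ∧ excursionFrom q w)) W
        ≡⟨ cong ((2 ^ d) ^ suc n *_) (trans (sumBy-cong W (λ w → iverson-∧ (inOrthant q) _)) (sym (*-distribˡ-sumBy (iverson (inOrthant q)) W _))) ⟩
      (2 ^ d) ^ suc n * (iverson (inOrthant q) * excursionsFrom q W)
        ≡⟨ solve 4 (λ A B i c → A :* B :* (i :* c) := i :* (A :* (B :* c))) refl (2 ^ d) ((2 ^ d) ^ n) (iverson (inOrthant q)) _ ⟩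
      iverson (inOrthant q) * (2 ^ d * ((2 ^ d) ^ n * excursionsFrom q W))
        ≡⟨ iverson-*-cong (inOrthant q) (λ q≥0 → cong (2 ^ d *_) (excursions-decouple n q q≥0)) ⟩
      iverson (inOrthant q) * (2 ^ d * sumBy (decoupled q) W)
        ≡⟨ trans (cong (iverson (inOrthant q) *_) (*-distribˡ-sumBy (2 ^ d) W (decoupled q))) (*-distribˡ-sumBy (iverson (inOrthant q)) W (λ w → 2 ^ d * decoupled q w)) ⟩
      sumBy (λ w → iverson (inOrthant q) * (2 ^ d * decoupled q w)) W
        ≡⟨ sumBy-cong W (iverson-inOrthant-decoupled p s) ⟩
      sumBy (λ w → weight (stepWeight p w) s) W ∎
      where q = p ⊕ s

module AlongAxis {d} (S : List (Pt d)) (k : Fin d) where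

  α β : ℕ
  α = sumBy (λ s → moves (lookup s k)) S
  β = sumBy (λ s → stays (lookup s k)) S

  open BinomialTransform α β public

  sumBy-words≡Ω : ∀ n (g : ℕ → ℕ → ℕ) → sumBy (λ w → g (movesAlong k w) (staysAlong k w)) (words S n) ≡ Ω n g
  sumBy-words≡Ω zero g = +-identityʳ _
  sumBy-words≡Ω (suc n) g = begin
    sumBy (λ w → g (movesAlong k w) (staysAlong k w)) (words S (suc n))
      ≡⟨ sumBy-words-suc (λ w → g (movesAlong k w) (staysAlong k w)) S n ⟩
    sumBy (λ s → sumBy (λ w → g (moves (lookup s k) + movesAlong k w) (stays (lookup s k) + staysAlong k w)) (words S n)) S
      ≡⟨ sumBy-cong S (λ s → by-first-step (moves-stays (lookup s k))) ⟩
    sumBy (λ s → moves (lookup s k) * Gm + stays (lookup s k) * Gz) S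
      ≡⟨ sumBy-+ S _ _ ⟩
    sumBy (λ s → moves (lookup s k) * Gm) S + sumBy (λ s → stays (lookup s k) * Gz) S
      ≡⟨ cong₂ _+_ (sym (*-distribʳ-sumBy Gm S (λ s → moves (lookup s k)))) (sym (*-distribʳ-sumBy Gz S (λ s → stays (lookup s k)))) ⟩
    α * Gm + β * Gz ∎
    where
    open ≡-Reasoning
    Gm = Ω n (λ m z → g (suc m) z)
    Gz = Ω n (λ m z → g m (suc z))
    by-first-step : ∀ {a b} → (a ≡ 0 × b ≡ 1) ⊎ (a ≡ 1 × b ≡ 0) →
      sumBy (λ w → g (a + movesAlong k w) (b + staysAlong k w)) (words S n) ≡ a * Gm + b * Gz
    by-first-step (inj₁ (refl , refl)) = trans (sumBy-words≡Ω n (λ m z → g m (suc z))) (sym (+-identityʳ Gz))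
    by-first-step (inj₂ (refl , refl)) = trans (sumBy-words≡Ω n (λ m z → g (suc m) z)) (sym (trans (+-identityʳ _) (+-identityʳ Gm)))

  α+β≡length : α + β ≡ length S
  α+β≡length = trans (sym (sumBy-+ S _ _)) (trans (sumBy-cong S (λ s → moves+stays (lookup s k))) (trans (sumBy-const S 1) (*-identityʳ _)))
    where
    moves+stays : ∀ x → moves x + stays x ≡ 1
    moves+stays x with moves-stays x
    ... | inj₁ (m≡0 , s≡1) rewrite m≡0 | s≡1 = refl
    ... | inj₂ (m≡1 , s≡0) rewrite m≡1 | s≡0 = refl

  α-positive : HasPositiveInEachCoord S → 1 ≤ α
  α-positive positive with positive k
  ... | s , s∈S , sk≡1 = subst (λ t → moves t ≤ α) sk≡1 (∈⇒≤sumBy (λ s → moves (lookup s k)) s∈S)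

factor² : ℕ → ℕ → ℕ
factor² m z = (walks⁺ 0 m * 2 ^ z) * (walks⁺ 0 m * 2 ^ z)

factor²-bound : ∀ m z → factor² m z * (suc m * suc m * suc m) ≤ 3 * 4 ^ (m + z)
factor²-bound m z = begin
  factor² m z * (suc m * suc m * suc m)
    ≡⟨ solve 3 (λ e t s → (e :* t) :* (e :* t) :* (s :* s :* s) := (e :* e :* (s :* s :* s)) :* (t :* t)) refl (walks⁺ 0 m) (2 ^ z) (suc m) ⟩
  (walks⁺ 0 m * walks⁺ 0 m * (suc m * suc m * suc m)) * (2 ^ z * 2 ^ z)
    ≤⟨ *-monoˡ-≤ (2 ^ z * 2 ^ z) (excursions-bound m) ⟩
  3 * 4 ^ m * (2 ^ z * 2 ^ z)   ≡⟨ cong (3 * 4 ^ m *_) (sym (*-^-distrib 2 2 z)) ⟩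
  3 * 4 ^ m * 4 ^ z             ≡⟨ *-assoc 3 (4 ^ m) (4 ^ z) ⟩
  3 * (4 ^ m * 4 ^ z)           ≡⟨ cong (3 *_) (sym (^-distribˡ-+-* 4 m z)) ⟩
  3 * 4 ^ (m + z) ∎
  where open ≤-Reasoning

factor²^-rising-bound : ∀ d n m z → m + z ≡ n →
  factor² m z ^ d * rising (suc m) (3 * d) ≤ suc (3 * d) ^ (3 * d) * (3 * 4 ^ n) ^ d
factor²^-rising-bound d n m z m+z≡n = begin
  t ^ d * rising (suc m) r              ≤⟨ *-monoʳ-≤ (t ^ d) (rising≤^ r (suc m)) ⟩
  t ^ d * (suc m + r) ^ r               ≤⟨ *-monoʳ-≤ (t ^ d) (^-monoˡ-≤ r sum≤product) ⟩
  t ^ d * (suc r * suc m) ^ r           ≡⟨ cong (t ^ d *_) (*-^-distrib (suc r) (suc m) r) ⟩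
  t ^ d * (suc r ^ r * suc m ^ r)       ≡⟨ solve 3 (λ g a b → g :* (a :* b) := a :* (g :* b)) refl (t ^ d) (suc r ^ r) (suc m ^ r) ⟩
  suc r ^ r * (t ^ d * suc m ^ (3 * d)) ≡⟨ cong (λ x → suc r ^ r * (t ^ d * x)) (sym (^-*-assoc (suc m) 3 d)) ⟩
  suc r ^ r * (t ^ d * (suc m ^ 3) ^ d) ≡⟨ cong (suc r ^ r *_) (sym (*-^-distrib t (suc m ^ 3) d)) ⟩
  suc r ^ r * (t * suc m ^ 3) ^ d       ≤⟨ *-monoʳ-≤ (suc r ^ r) (^-monoˡ-≤ d cubed) ⟩
  suc r ^ r * (3 * 4 ^ n) ^ d ∎
  where
  open ≤-Reasoning
  r = 3 * d
  t = factor² m z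
  sum≤product : suc m + r ≤ suc r * suc m
  sum≤product = subst (suc m + r ≤_) (solve 2 (λ m r → (con 1 :+ m) :+ r :* (con 1 :+ m) := (con 1 :+ r) :* (con 1 :+ m)) refl m r)
    (+-monoʳ-≤ (suc m) (m≤m*n r (suc m)))
  cubed : t * suc m ^ 3 ≤ 3 * 4 ^ n
  cubed = subst₂ _≤_ (cong (t *_) (solve 1 (λ s → s :* s :* s := s :* (s :* (s :* con 1))) refl (suc m)))
    (cong (λ x → 3 * 4 ^ x) m+z≡n) (factor²-bound m z)

module _ (D : ℕ) (S : List (Pt (suc D))) (step-set : IsStepSet S) (symmetric : AxisSymmetric S)
         (positive : HasPositiveInEachCoord S) where

  private
    d = suc D
    r = 3 * d
    L = length S
    o = origin {d}

  M : ℕ → ℕ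
  M n = suc r ^ r * (3 * 4 ^ n) ^ d

  Ω-factor²-bound : ∀ n k → n ^ r * AlongAxis.Ω S k n (λ m z → factor² m z ^ d) ≤ M n * L ^ (n + r)
  Ω-factor²-bound n k = begin
    n ^ r * Ωk                        ≤⟨ *-monoˡ-≤ Ωk (^≤rising r (n≤1+n n)) ⟩
    rising (suc n) r * Ωk             ≤⟨ m≤m*n (rising (suc n) r * Ωk) (α ^ r) {{α^r≢0}} ⟩
    rising (suc n) r * Ωk * α ^ r     ≡⟨ solve 3 (λ a b c → a :* b :* c := b :* c :* a) refl (rising (suc n) r) Ωk (α ^ r) ⟩
    Ωk * α ^ r * rising (suc n) r     ≤⟨ Ω-rising-bound r n _ (M n) (factor²^-rising-bound d n) ⟩
    M n * (α + β) ^ (n + r)           ≡⟨ cong (λ t → M n * t ^ (n + r)) α+β≡length ⟩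
    M n * L ^ (n + r) ∎
    where
    open ≤-Reasoning
    open AlongAxis S k
    Ωk = Ω n (λ m z → factor² m z ^ d)
    α^r≢0 : NonZero (α ^ r)
    α^r≢0 = >-nonZero (≤-trans (≤-reflexive (sym (^-zeroˡ r))) (^-monoˡ-≤ r (α-positive positive)))

  decoupled-origin² : ∀ w → decoupled o w * decoupled o w ≡ prodᶠ (λ k → factor² (movesAlong k w) (staysAlong k w))
  decoupled-origin² w = trans (cong₂ _*_ at-origin at-origin) (sym (prodᶠ-* factor factor))
    where
    factor : Fin d → ℕ
    factor k = walks⁺ 0 (movesAlong k w) * 2 ^ staysAlong k w
    at-origin : decoupled o w ≡ prodᶠ factor
    at-origin = prodᶠ-cong (λ k → cong (λ t → walksFrom⁺ t (movesAlong k w) * 2 ^ staysAlong k w) (lookup-replicate k 0ℤ))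

  sumBy-decoupled²-bound : ∀ n → n ^ r * sumBy (λ w → decoupled o w * decoupled o w) (words S n) ≤ d * (M n * L ^ (n + r))
  sumBy-decoupled²-bound n = begin
    n ^ r * sumBy (λ w → decoupled o w * decoupled o w) W
      ≤⟨ *-monoʳ-≤ (n ^ r) (sumBy-mono W (λ w → subst (_≤ sumᶠ (F w)) (sym (decoupled-origin² w)) (prodᶠ≤sumᶠ-^ (factors w)))) ⟩
    n ^ r * sumBy (λ w → sumᶠ (F w)) W
      ≡⟨ cong (n ^ r *_) (trans (sumBy-sumᶠ W F) (sumᶠ-cong (λ k → AlongAxis.sumBy-words≡Ω S k n (λ m z → factor² m z ^ d)))) ⟩
    n ^ r * sumᶠ Ωk
      ≡⟨ *-distribˡ-sumᶠ (n ^ r) Ωk ⟩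
    sumᶠ (λ k → n ^ r * Ωk k)
      ≤⟨ sumᶠ-mono (Ω-factor²-bound n) ⟩
    sumᶠ {d} (λ _ → M n * L ^ (n + r))
      ≡⟨ sumᶠ-const d _ ⟩
    d * (M n * L ^ (n + r)) ∎
    where
    open ≤-Reasoning
    W = words S n
    factors : List (Pt d) → Fin d → ℕ
    factors w k = factor² (movesAlong k w) (staysAlong k w)
    F : List (Pt d) → Fin d → ℕ
    F w k = factors w k ^ d
    Ωk : Fin d → ℕ
    Ωk k = AlongAxis.Ω S k n (λ m z → factor² m z ^ d)

  C : ℕ
  C = d * suc r ^ r * 3 ^ d * L ^ r

  excursionCount-decoupled : ∀ n → (2 ^ d) ^ n * excursionCount S n ≡ sumBy (decoupled o) (words S n)
  excursionCount-decoupled n = trans (cong ((2 ^ d) ^ n *_) (length-filter-T? isExcursion (words S n)))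
    (Decoupling.excursions-decouple S (proj₁ step-set) symmetric (λ s∈S → proj₁ (proj₂ step-set s∈S)) n o (inOrthant-origin d))

  -- The factor 2^(2 d n) = 4^(d n) from the decoupling is absorbed by M n.
  excursionCount-bound : ∀ n → excursionCount S n ^ 2 * n ^ r ≤ C * L ^ (2 * n)
  excursionCount-bound n = *-cancelˡ-≤ ((4 ^ n) ^ d) {{m^n≢0 (4 ^ n) d {{m^n≢0 4 n}}}} (begin
    (4 ^ n) ^ d * (e ^ 2 * n ^ r)
      ≡⟨ cong (λ t → t * (e ^ 2 * n ^ r)) (sym (2^dn²≡4^nd d n)) ⟩
    (2 ^ d) ^ n * (2 ^ d) ^ n * (e ^ 2 * n ^ r)
      ≡⟨ solve 3 (λ a e N → a :* a :* ((e :* (e :* con 1)) :* N) := (a :* e) :* (a :* e) :* N) refl ((2 ^ d) ^ n) e (n ^ r) ⟩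
    ((2 ^ d) ^ n * e) * ((2 ^ d) ^ n * e) * n ^ r
      ≡⟨ cong (λ t → t * t * n ^ r) (excursionCount-decoupled n) ⟩
    sumBy (decoupled o) W * sumBy (decoupled o) W * n ^ r
      ≤⟨ *-monoˡ-≤ (n ^ r) (sumBy-cauchySchwarz (decoupled o) W) ⟩
    length W * Σ² * n ^ r
      ≡⟨ trans (*-assoc (length W) Σ² (n ^ r)) (cong₂ _*_ (length-words S n) (*-comm Σ² (n ^ r))) ⟩
    L ^ n * (n ^ r * Σ²)
      ≤⟨ *-monoʳ-≤ (L ^ n) (sumBy-decoupled²-bound n) ⟩
    L ^ n * (d * (M n * L ^ (n + r)))
      ≡⟨ collect-constants ⟩
    (4 ^ n) ^ d * (C * L ^ (2 * n)) ∎)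
    where
    open ≤-Reasoning
    e = excursionCount S n
    W = words S n
    Σ² = sumBy (λ w → decoupled o w * decoupled o w) W
    collect-constants : L ^ n * (d * (M n * L ^ (n + r))) ≡ (4 ^ n) ^ d * (C * L ^ (2 * n))
    collect-constants = begin-equality
      L ^ n * (d * (suc r ^ r * (3 * 4 ^ n) ^ d * L ^ (n + r)))
        ≡⟨ cong₂ (λ a b → L ^ n * (d * (suc r ^ r * a * b))) (*-^-distrib 3 (4 ^ n) d) (^-distribˡ-+-* L n r) ⟩
      L ^ n * (d * (suc r ^ r * (3 ^ d * (4 ^ n) ^ d) * (L ^ n * L ^ r)))
        ≡⟨ solve 6 (λ Ln d s t q lr → Ln :* (d :* (s :* (t :* q) :* (Ln :* lr))) := q :* (d :* s :* t :* lr :* (Ln :* Ln)))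
             refl (L ^ n) d (suc r ^ r) (3 ^ d) ((4 ^ n) ^ d) (L ^ r) ⟩
      (4 ^ n) ^ d * (C * (L ^ n * L ^ n))
        ≡⟨ cong (λ t → (4 ^ n) ^ d * (C * t)) (sym (^-double L n)) ⟩
      (4 ^ n) ^ d * (C * L ^ (2 * n)) ∎

excursionFrom-dim0 : ∀ (p : Pt 0) w → excursionFrom p w ≡ true
excursionFrom-dim0 [] [] = refl
excursionFrom-dim0 [] ([] ∷ w) = excursionFrom-dim0 [] w

excursionCount-dim0 : ∀ (S : List (Pt 0)) n → excursionCount S n ≡ length S ^ n
excursionCount-dim0 S n = begin
  excursionCount S n                ≡⟨ length-filter-T? isExcursion (words S n) ⟩
  sumBy (iverson ∘ isExcursion) W   ≡⟨ sumBy-cong W (λ w → cong iverson (excursionFrom-dim0 origin w)) ⟩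
  sumBy (λ _ → 1) W                 ≡⟨ trans (sumBy-const W 1) (*-identityʳ _) ⟩
  length W                          ≡⟨ length-words S n ⟩
  length S ^ n ∎
  where
  open ≡-Reasoning
  W = words S n

theorem7p2 : (d : ℕ) (S : List (Pt d)) →
    IsStepSet S → AxisSymmetric S → HasPositiveInEachCoord S →
    Σ ℕ (λ C → Σ ℕ (λ N → (n : ℕ) → N ≤ n →
    (excursionCount S n ^ 2) * (n ^ (3 * d)) ≤ C * (length S ^ (2 * n))))
theorem7p2 zero S _ _ _ = 1 , 0 , λ n _ → ≤-reflexive (begin
  excursionCount S n ^ 2 * 1        ≡⟨ cong (λ e → e ^ 2 * 1) (excursionCount-dim0 S n) ⟩
  (length S ^ n) ^ 2 * 1            ≡⟨ solve 1 (λ x → (x :* (x :* con 1)) :* con 1 := con 1 :* (x :* x)) refl (length S ^ n) ⟩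
  1 * (length S ^ n * length S ^ n) ≡⟨ cong (1 *_) (sym (^-double (length S) n)) ⟩
  1 * length S ^ (2 * n) ∎)
  where open ≡-Reasoning
theorem7p2 (suc D) S step-set symmetric positive =
  C D S step-set symmetric positive , 0 , λ n _ → excursionCount-bound D S step-set symmetric positive n
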